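{- Let $w \ge 0$ and $N \ge 1$ be integers. If there is a strategy that, using at most $w$ weighings, is guaranteed to find the alternator among $N$ coins when the alternator starts in the $f$-state, then $N \le J_{w+2}$. If there is such a strategy using at most $w$ weighings when the alternator starts in the $r$-state, or when its starting state is unknown, then $N \le J_{w+1}$. Here $J_m = (2^m-(-1)^m)/3$.
   Context: Setting (alternator coin problem): There are $N$ identical-looking coins. All but one are real and have the same weight. The remaining coin, the alternator, behaves as follows: each time it is placed on a balance scale it weighs either the same as a real coin ("acts real") or strictly less than a real coin ("acts fake"), and it switches between these two behaviours every time it is on the scale; while off the scale its behaviour does not change. A weighing places two disjoint sets of coins with the same number of coins on the two pans, and its outcome is one of: the pans balance, the left pan is lighter, or the right pan is lighter. Weighings may be chosen adaptively based on earlier outcomes. A strategy finds the alternator if, for every possible identity of the alternator, the outcomes determine which coin it is. The alternator is in the $f$-state if the next time it is on the scale it will act fake, and in the $r$-state if the next time it is on the scale it will act real; "unknown starting state" means it may start in either state. $J_m = (2^m-(-1)^m)/3$ is the $m$-th Jacobsthal number ($J_0=0,J_1=1,J_2=1,J_3=3,J_4=5,\dots$). -}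

module Defs where

open import Data.Nat using (ℕ; zero; suc; _+_; _∸_; _^_; _/_; _%_)
open import Data.Bool using (Bool; true; false; not; if_then_else_)
open import Data.Fin using (Fin)
open import Data.Fin.Subset using (Subset; _∩_; ∣_∣; ⊥)
open import Data.Vec using (lookup)
open import Data.Product using (_×_; _,_)
open import Data.Unit using (⊤)
open import Relation.Binary.PropositionalEquality using (_≡_)

-- Jacobsthal numbers J_m = (2^m - (-1)^m)/3, written in ℕ:
-- for m even this is (2^m - 1)/3, for m odd (2^m + 1)/3.
J : ℕ → ℕ
J m = ((2 ^ m + m % 2) ∸ (1 ∸ m % 2)) / 3

record Weighing (N : ℕ) : Set where
  field
    left     : Subset N
    right    : Subset N
    disjoint : left ∩ right ≡ ⊥
    sameSize : ∣ left ∣ ≡ ∣ right ∣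
open Weighing public

data Outcome : Set where
  balance leftLighter rightLighter : Outcome

-- Alternator state: true = f-state (acts fake next time on the scale),
-- false = r-state (acts real next time on the scale).
State : Set
State = Bool

weighOutcome : ∀ {N} → Weighing N → Fin N → State → Outcome × State
weighOutcome W a s with lookup (left W) a | lookup (right W) a
... | true  | _     = (if s then leftLighter  else balance) , not s
... | false | true  = (if s then rightLighter else balance) , not s
... | false | false = balance , s

-- Adaptive strategies using at most w weighings: decision trees of depth ≤ w
-- whose leaves announce the coin claimed to be the alternator.
data Strategy (N : ℕ) : ℕ → Set where
  answer : ∀ {w} → Fin N → Strategy N w
  weigh  : ∀ {w} → Weighing N → (Outcome → Strategy N w) → Strategy N (suc w)

run : ∀ {N w} → Strategy N w → Fin N → State → Fin N
run (answer c)  a s = c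
run (weigh W k) a s with weighOutcome W a s
... | o , s' = run (k o) a s'

Finds : ∀ {N w} → (State → Set) → Strategy N w → Set
Finds Start σ = ∀ a s → Start s → run σ a s ≡ a

StartF : State → Set
StartF s = s ≡ true

StartR : State → Set
StartR s = s ≡ false

StartUnknown : State → Set
StartUnknown s = ⊤

module Submission where

-- Idea (information counting).  Along a run of a strategy, record the
-- sequence of outcomes, padding with "balance" once an answer is given.
-- Since the answer depends only on this outcome sequence, a strategy that
-- finds the alternator must give distinct coins distinct sequences.  But the
-- alternator constrains which sequences can occur: in the r-state it cannot
-- make a pan lighter, and after acting fake it is in the r-state.  The
-- admissible sequences of length w from the f-state and from the r-state are
-- enumerated explicitly ('outcomes'); their numbers satisfy the Jacobsthal
-- recurrence a(w+1) = a(w) + 2 b(w), b(w+1) = a(w), giving J(w+2) and J(w+1).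

open import Defs
open import Data.Nat using (ℕ; suc; _+_; _≤_)
open import Data.Product using (_×_; Σ)

open import Data.Nat using (zero; _*_; _∸_; _^_; _/_; _%_)
open import Data.Nat.Properties using (+-assoc; +-comm; *-comm; m+n∸n≡m)
open import Data.Nat.DivMod using (m*n/n≡m)
open import Data.Nat.Tactic.RingSolver using (solve-∀)
open import Data.Bool using (true; false)
open import Data.Fin using (Fin)
open import Data.Fin.Properties using (injective⇒≤)
open import Data.Vec using (Vec; []; _∷_; replicate; lookup)
open import Data.Vec.Properties using (∷-injectiveˡ; ∷-injectiveʳ)
open import Data.List using (List; length; map; _++_) renaming ([] to []ₗ; _∷_ to _∷ₗ_)
open import Data.List.Properties using (length-map; length-++)
open import Data.List.Relation.Unary.Any using (here; index)
open import Data.List.Membership.Propositional using (_∈_)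
open import Data.List.Membership.Propositional.Properties using (∈-map⁺; ∈-++⁺ˡ; ∈-++⁺ʳ)
open import Data.List.Membership.Setoid.Properties using (index-injective)
open import Data.Product using (_,_; proj₁; proj₂)
open import Data.Unit using (tt)
open import Relation.Binary.PropositionalEquality
  using (_≡_; refl; sym; trans; cong; cong₂; subst; setoid; module ≡-Reasoning)

-- The Jacobsthal numbers defined by their recurrence
-- J(m+2) = J(m+1) + 2 J(m), the form in which they count outcome sequences.
jacobsthal : ℕ → ℕ
jacobsthal zero          = 0
jacobsthal (suc zero)    = 1
jacobsthal (suc (suc m)) = jacobsthal (suc m) + jacobsthal m + jacobsthal m

jacobsthal-sum : ∀ m → jacobsthal m + jacobsthal (suc m) ≡ 2 ^ m
jacobsthal-sum zero    = refl
jacobsthal-sum (suc m) = begin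
  b + (b + a + a)  ≡⟨ regroup a b ⟩
  2 * (a + b)      ≡⟨ cong (2 *_) (jacobsthal-sum m) ⟩
  2 * 2 ^ m        ∎
  where
  open ≡-Reasoning
  a = jacobsthal m
  b = jacobsthal (suc m)
  regroup : ∀ a b → b + (b + a + a) ≡ 2 * (a + b)
  regroup = solve-∀

-- J(m+1) = 2 J(m) + (-1)^m, written without subtraction.
jacobsthal-next : ∀ m → jacobsthal (suc m) + m % 2 ≡ 2 * jacobsthal m + (1 ∸ m % 2)
jacobsthal-next zero          = refl
jacobsthal-next (suc zero)    = refl
jacobsthal-next (suc (suc m)) = begin
  (b + a + a + b + b) + r   ≡⟨ regroup₁ a b r ⟩
  2 * (a + b) + (b + r)     ≡⟨ cong (2 * (a + b) +_) (jacobsthal-next m) ⟩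
  2 * (a + b) + (2 * a + e) ≡⟨ regroup₂ a b e ⟩
  2 * (b + a + a) + e       ∎
  where
  open ≡-Reasoning
  a = jacobsthal m
  b = jacobsthal (suc m)
  r = m % 2
  e = 1 ∸ m % 2
  regroup₁ : ∀ a b r → (b + a + a + b + b) + r ≡ 2 * (a + b) + (b + r)
  regroup₁ = solve-∀
  regroup₂ : ∀ a b e → 2 * (a + b) + (2 * a + e) ≡ 2 * (b + a + a) + e
  regroup₂ = solve-∀

-- 3 J(m) = 2^m - (-1)^m, again written without subtraction.
jacobsthal-closed : ∀ m → 3 * jacobsthal m + (1 ∸ m % 2) ≡ 2 ^ m + m % 2
jacobsthal-closed m = begin
  3 * a + e                        ≡⟨ regroup a e ⟩
  a + (2 * a + e)                  ≡⟨ cong (a +_) (sym (jacobsthal-next m)) ⟩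
  a + (jacobsthal (suc m) + m % 2) ≡⟨ sym (+-assoc a _ _) ⟩
  (a + jacobsthal (suc m)) + m % 2 ≡⟨ cong (_+ m % 2) (jacobsthal-sum m) ⟩
  2 ^ m + m % 2                    ∎
  where
  open ≡-Reasoning
  a = jacobsthal m
  e = 1 ∸ m % 2
  regroup : ∀ a e → 3 * a + e ≡ a + (2 * a + e)
  regroup = solve-∀

J≡jacobsthal : ∀ m → J m ≡ jacobsthal m
J≡jacobsthal m = begin
  ((2 ^ m + m % 2) ∸ e) / 3         ≡⟨ cong (λ x → (x ∸ e) / 3) (sym (jacobsthal-closed m)) ⟩
  ((3 * jacobsthal m + e) ∸ e) / 3  ≡⟨ cong (_/ 3) (m+n∸n≡m (3 * jacobsthal m) e) ⟩
  (3 * jacobsthal m) / 3            ≡⟨ cong (_/ 3) (*-comm 3 (jacobsthal m)) ⟩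
  (jacobsthal m * 3) / 3            ≡⟨ m*n/n≡m (jacobsthal m) 3 ⟩
  jacobsthal m                      ∎
  where
  open ≡-Reasoning
  e = 1 ∸ m % 2

-- The transitions of the alternator in one weighing, as (state before,
-- outcome, state after).
data Step : State → Outcome → State → Set where
  offScale   : ∀ {s} → Step s balance s
  actsReal   : Step false balance true
  actsFakeL  : Step true leftLighter false
  actsFakeR  : Step true rightLighter false

weighStep : ∀ {N} (W : Weighing N) a s →
            Step s (proj₁ (weighOutcome W a s)) (proj₂ (weighOutcome W a s))
weighStep W a s with lookup (left W) a | lookup (right W) a
weighStep W a true  | true  | _     = actsFakeL
weighStep W a false | true  | _     = actsReal
weighStep W a true  | false | true  = actsFakeR
weighStep W a false | false | true  = actsReal
weighStep W a s     | false | false = offScale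

-- An r-coin can only
-- produce a balance, after which it may be in either state; since every
-- sequence admissible from the r-state is also admissible from the f-state
-- (next lemma), it suffices to continue from the f-state.
outcomes : State → (w : ℕ) → List (Vec Outcome w)
outcomes s     zero    = [] ∷ₗ []ₗ
outcomes true  (suc w) = map (balance ∷_) (outcomes true w)
                         ++ map (leftLighter ∷_) (outcomes false w)
                         ++ map (rightLighter ∷_) (outcomes false w)
outcomes false (suc w) = map (balance ∷_) (outcomes true w)

-- Every sequence admissible from the r-state is admissible from the f-state:
-- the r-state list is the initial (balance-first) block of the f-state list.
outcomes-r⊆f : ∀ {w v} → v ∈ outcomes false w → v ∈ outcomes true w
outcomes-r⊆f {zero}  v∈ = v∈
outcomes-r⊆f {suc w} v∈ = ∈-++⁺ˡ v∈

step-extends : ∀ {w s o s'} {v : Vec Outcome w} →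
               Step s o s' → v ∈ outcomes s' w → (o ∷ v) ∈ outcomes s (suc w)
step-extends {s = true}  offScale v∈ = ∈-++⁺ˡ (∈-map⁺ _ v∈)
step-extends {s = false} offScale v∈ = ∈-map⁺ _ (outcomes-r⊆f v∈)
step-extends actsReal  v∈ = ∈-map⁺ _ v∈
step-extends {w} actsFakeL v∈ =
  ∈-++⁺ʳ (map (balance ∷_) (outcomes true w)) (∈-++⁺ˡ (∈-map⁺ (leftLighter ∷_) v∈))
step-extends {w} actsFakeR v∈ =
  ∈-++⁺ʳ (map (balance ∷_) (outcomes true w))
    (∈-++⁺ʳ (map (leftLighter ∷_) (outcomes false w)) (∈-map⁺ (rightLighter ∷_) v∈))

balances-admissible : ∀ w s → replicate w balance ∈ outcomes s w
balances-admissible zero    s = here refl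
balances-admissible (suc w) s = step-extends offScale (balances-admissible w s)

capacity : State → ℕ → ℕ
capacity true  w = jacobsthal (suc (suc w))
capacity false w = jacobsthal (suc w)

length-outcomes : ∀ s w → length (outcomes s w) ≡ capacity s w
length-outcomes true  zero    = refl
length-outcomes false zero    = refl
length-outcomes false (suc w) =
  trans (length-map (balance ∷_) (outcomes true w)) (length-outcomes true w)
length-outcomes true  (suc w) = begin
  length (map (balance ∷_) T ++ map (leftLighter ∷_) F ++ map (rightLighter ∷_) F)
    ≡⟨ length-++ (map (balance ∷_) T) ⟩
  length (map (balance ∷_) T) + length (map (leftLighter ∷_) F ++ map (rightLighter ∷_) F)
    ≡⟨ cong (length (map (balance ∷_) T) +_) (length-++ (map (leftLighter ∷_) F)) ⟩
  length (map (balance ∷_) T) + (length (map (leftLighter ∷_) F) + length (map (rightLighter ∷_) F))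
    ≡⟨ cong₂ _+_ (length-map _ T) (cong₂ _+_ (length-map _ F) (length-map _ F)) ⟩
  length T + (length F + length F)
    ≡⟨ cong₂ (λ x y → x + (y + y)) (length-outcomes true w) (length-outcomes false w) ⟩
  capacity true w + (capacity false w + capacity false w)
    ≡⟨ sym (+-assoc (capacity true w) _ _) ⟩
  capacity true (suc w) ∎
  where
  open ≡-Reasoning
  T = outcomes true w
  F = outcomes false w

trace : ∀ {N w} → Strategy N w → Fin N → State → Vec Outcome w
trace (answer {w} c) a s = replicate w balance
trace (weigh W k)    a s with weighOutcome W a s
... | o , s' = o ∷ trace (k o) a s'

trace-admissible : ∀ {N w} (σ : Strategy N w) a s → trace σ a s ∈ outcomes s w
trace-admissible (answer {w} c) a s = balances-admissible w s
trace-admissible (weigh W k)    a s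
  with weighOutcome W a s | weighStep W a s
... | o , s' | step = step-extends step (trace-admissible (k o) a s')

trace-determines-run : ∀ {N w} (σ : Strategy N w) a s b t →
                       trace σ a s ≡ trace σ b t → run σ a s ≡ run σ b t
trace-determines-run (answer c)  a s b t same = refl
trace-determines-run (weigh W k) a s b t same
  with weighOutcome W a s | weighOutcome W b t
... | o , s' | o' , t' with ∷-injectiveˡ same
...   | refl = trace-determines-run (k o) a s' b t' (∷-injectiveʳ same)

-- A strategy that finds the alternator starting in state s injects the coins
-- into the admissible sequences (via the position of their traces), so there
-- are at most capacity s w coins.
strategy-bound : ∀ {N w} s (σ : Strategy N w) → (∀ a → run σ a s ≡ a) → N ≤ capacity s w
strategy-bound {N} {w} s σ finds =
  subst (N ≤_) (length-outcomes s w) (injective⇒≤ {f = position} position-injective)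
  where
  position : Fin N → Fin (length (outcomes s w))
  position a = index (trace-admissible σ a s)
  position-injective : ∀ {a b} → position a ≡ position b → a ≡ b
  position-injective {a} {b} same = begin
    a            ≡⟨ sym (finds a) ⟩
    run σ a s    ≡⟨ trace-determines-run σ a s b s
                      (index-injective (setoid _) (trace-admissible σ a s) (trace-admissible σ b s) same) ⟩
    run σ b s    ≡⟨ finds b ⟩
    b            ∎
    where open ≡-Reasoning

mainTheorem4 : (w N : ℕ) → 1 ≤ N →
    ((Σ (Strategy N w) (Finds StartF)) → N ≤ J (w + 2))
    × ((Σ (Strategy N w) (Finds StartR)) → N ≤ J (w + 1))
    × ((Σ (Strategy N w) (Finds StartUnknown)) → N ≤ J (w + 1))
mainTheorem4 w N _ =
    (λ (σ , finds) → subst (N ≤_) (sym J-f) (strategy-bound true  σ (λ a → finds a true refl)))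
  , (λ (σ , finds) → subst (N ≤_) (sym J-r) (strategy-bound false σ (λ a → finds a false refl)))
  , (λ (σ , finds) → subst (N ≤_) (sym J-r) (strategy-bound false σ (λ a → finds a false tt)))
  where
  J-f : J (w + 2) ≡ capacity true w
  J-f = trans (J≡jacobsthal (w + 2)) (cong jacobsthal (+-comm w 2))
  J-r : J (w + 1) ≡ capacity false w
  J-r = trans (J≡jacobsthal (w + 1)) (cong jacobsthal (+-comm w 1))
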